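{- Let $\sigma\in\mathbb{Z}_{>0}$, $T\in[0..\sigma)^n$, and let $G$ be a 1D SLP representing $T$. There exists a 2D SLG $G'$ of size $|G'|=\mathcal{O}(|G|+\sigma)$ that represents $\mathrm{MarkAllChars}(T,\sigma)$.
   Context: $\mathrm{MarkAllChars}(T,\sigma)\in\{0,1\}^{\sigma\times n}$ is the matrix whose entry in row $c+1$ and column $j$ ($c\in[0..\sigma)$, $j\in[1..n]$) is $1$ if $T[j]=c$ and $0$ otherwise. 1D SLP: $G=(V,\Sigma,R,S)$, each $N\in V$ has exactly one rule $N\to\mathrm{rhs}(N)$ with $\mathrm{rhs}(N)\in\Sigma$ or $\mathrm{rhs}(N)=AB$ ($A,B\in V$), with an ordering $N_1,\dots,N_{|V|}$ such that $\mathrm{rhs}(N_i)$ only uses $N_j$, $j>i$; $G$ represents the string derived from $S$; $|G|=\sum_{N\in V}\max(|\mathrm{rhs}(N)|,1)$. 2D SLG: $G'=(V_l,V_h,V_v,\Sigma',R',S')$ with $V_l$ (nonempty), $V_h,V_v,\Sigma'$ pairwise disjoint finite sets, $V=V_l\cup V_h\cup V_v$, $S'\in V$; each $N\in V_l$ has $\mathrm{rhs}(N)\in\Sigma'$, each $N\in V_h\cup V_v$ has $\mathrm{rhs}(N)$ a string over $V$, with an ordering $N_1,\dots,N_{|V|}$ such that $\mathrm{rhs}(N_i)$ only uses $N_j$, $j>i$. Expansions: $N\in V_l$ gives the $1\times1$ matrix $\mathrm{rhs}(N)$; for $N\in V_h$ the expansions of the symbols of $\mathrm{rhs}(N)$ (required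 to have equal numbers of columns) are stacked top to bottom in order; for $N\in V_v$ they (required to have equal numbers of rows) are placed left to right in order. $G'$ represents $\mathrm{exp}(S')$; $|G'|=\sum_{N\in V}\max(|\mathrm{rhs}(N)|,1)$. -}

module Defs where

open import Data.Nat using (ℕ; zero; suc; _+_; _⊔_; _≟_)
open import Data.Fin using (Fin; zero; suc; toℕ)
import Data.Fin as Fin
open import Data.List using (List; []; _∷_; length) renaming (_++_ to _++ₗ_)
open import Data.Vec using (Vec; []; _∷_; _++_; zipWith; tabulate; map)
open import Data.Maybe using (Maybe; just; nothing; _>>=_)
open import Data.Product using (Σ; _,_)
open import Data.Bool using (if_then_else_)
open import Relation.Nullary using (yes; no; does)
open import Relation.Binary.PropositionalEquality using (refl)

-- The rule list is built so that the
-- newest rule (index zero) may only refer to older rules; this is the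
-- required ordering N₁,…,N_|V| (rhs(Nᵢ) only uses Nⱼ, j > i) read with
-- Nᵢ = index (i - 1).

data Rule1 (k : ℕ) : Set where
  term : ℕ → Rule1 k
  pair : Fin k → Fin k → Rule1 k

data SLP : ℕ → Set where
  []  : SLP 0
  _▷_ : ∀ {k} → SLP k → Rule1 k → SLP (suc k)

exp1 : ∀ {k} → SLP k → Fin k → List ℕ
exp1 (g ▷ term a)   zero    = a ∷ []
exp1 (g ▷ pair A B) zero    = exp1 g A ++ₗ exp1 g B
exp1 (g ▷ r)        (suc i) = exp1 g i

size1 : ∀ {k} → SLP k → ℕ
size1 []             = 0
size1 (g ▷ term _)   = size1 g + 1
size1 (g ▷ pair _ _) = size1 g + 2

Mat : Set
Mat = Σ ℕ λ r → Σ ℕ λ c → Vec (Vec ℕ c) r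

vcat : Mat → Mat → Maybe Mat
vcat (r₁ , c₁ , M₁) (r₂ , c₂ , M₂) with c₁ ≟ c₂
... | yes refl = just (r₁ + r₂ , c₁ , M₁ ++ M₂)
... | no _     = nothing

hcat : Mat → Mat → Maybe Mat
hcat (r₁ , c₁ , M₁) (r₂ , c₂ , M₂) with r₁ ≟ r₂
... | yes refl = just (r₁ , c₁ + c₂ , zipWith _++_ M₁ M₂)
... | no _     = nothing

foldCat : (Mat → Mat → Maybe Mat) → Mat → List Mat → Maybe Mat
foldCat f acc []       = just acc
foldCat f acc (m ∷ ms) = f acc m >>= λ a → foldCat f a ms

catAll : (Mat → Mat → Maybe Mat) → List Mat → Maybe Mat
catAll f []       = nothing
catAll f (m ∷ ms) = foldCat f m ms

sequenceM : List (Maybe Mat) → Maybe (List Mat)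
sequenceM []       = just []
sequenceM (x ∷ xs) = x >>= λ m → sequenceM xs >>= λ ms → just (m ∷ ms)

mapL : ∀ {A B : Set} → (A → B) → List A → List B
mapL f []       = []
mapL f (x ∷ xs) = f x ∷ mapL f xs

data Rule2 (k : ℕ) : Set where
  leaf : ℕ → Rule2 k
  hrul : List (Fin k) → Rule2 k   -- N ∈ V_h,  expansions stacked top to bottom
  vrul : List (Fin k) → Rule2 k   -- N ∈ V_v,  expansions placed left to right

data SLG : ℕ → Set where
  []  : SLG 0
  _▷_ : ∀ {k} → SLG k → Rule2 k → SLG (suc k)

exp2 : ∀ {k} → SLG k → Fin k → Maybe Mat
exp2 (g ▷ leaf a)  zero    = just (1 , 1 , (a ∷ []) ∷ [])
exp2 (g ▷ hrul xs) zero    = sequenceM (mapL (exp2 g) xs) >>= catAll vcat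
exp2 (g ▷ vrul xs) zero    = sequenceM (mapL (exp2 g) xs) >>= catAll hcat
exp2 (g ▷ r)       (suc i) = exp2 g i

size2 : ∀ {k} → SLG k → ℕ
size2 []            = 0
size2 (g ▷ leaf _)  = size2 g + 1
size2 (g ▷ hrul xs) = size2 g + (length xs ⊔ 1)
size2 (g ▷ vrul xs) = size2 g + (length xs ⊔ 1)

hasLeaf : ∀ {k} → SLG k → Set
hasLeaf []           = Data.Empty.⊥
  where import Data.Empty
hasLeaf (g ▷ leaf _) = Data.Unit.⊤
  where import Data.Unit
hasLeaf (g ▷ hrul _) = hasLeaf g
hasLeaf (g ▷ vrul _) = hasLeaf g

markAllChars : (σ : ℕ) → ∀ {n} → Vec (Fin σ) n → Vec (Vec ℕ n) σ
markAllChars σ T = tabulate λ c → map (λ t → if does (t Fin.≟ c) then 1 else 0) T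

{-# OPTIONS --safe #-}
-- The base grammar consists of the leaves 0 and 1 and the zero columns 0^h, 1 ≤ h ≤ σ,
-- each built from the previous one by a two-symbol stacking rule, at total cost 2σ.
-- A terminal rule N → a becomes the rule stacking 0^a, 1 and 0^(σ-1-a) (empty pieces
-- dropped), which is exactly column a of MarkAllChars; a rule N → A B becomes the rule
-- placing A left of B.  By induction every nonterminal N then expands to
-- MarkAllChars(exp N, σ), and each rule of G, of size c ≤ 2, costs at most 3 ≤ 3c.
module Submission where

open import Defs
open import Data.Nat using (ℕ; _+_; _*_; _≤_; _<_)
open import Data.Fin using (Fin; toℕ)
open import Data.Vec using (Vec; toList; map)
open import Data.Maybe using (just; Is-just)
open import Data.Product using (Σ; ∃; _×_; _,_)
open import Relation.Binary.PropositionalEquality using (_≡_)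

open import Function using (_∘_)
open import Data.Nat using (zero; suc; z≤n; s≤s; s≤s⁻¹; _∸_; _≤?_; _≟_)
open import Data.Nat.Properties
  using (≟-diag; ≤∧≢⇒<; ≤-refl; ≤-trans; ≤-reflexive; n≤1+n; ≰⇒>; m∸n≤m; +-mono-≤; *-monoˡ-≤; ⊔-lub)
open import Data.Nat.Tactic.RingSolver using (solve-∀)
open import Data.Fin using (zero; suc; _↑ˡ_; _↑ʳ_; fromℕ) renaming (_≟_ to _≟ᶠ_)
open import Data.List using (List; []; _∷_; length; replicate) renaming (_++_ to _++ₗ_)
open import Data.List.Properties using (++-assoc; length-++)
open import Data.Vec using ([]; _∷_; _++_; zipWith; tabulate; fromList; cast)
import Data.Vec.Properties as Vec
open import Data.Vec.Relation.Binary.Equality.Cast using (cast-is-id)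
open import Data.Maybe using (Maybe; _>>=_)
open import Data.Maybe.Relation.Unary.Any using (just)
open import Data.Bool using (if_then_else_)
open import Data.Unit using (tt)
open import Relation.Nullary using (yes; no; does)
open import Relation.Binary.PropositionalEquality using (refl; sym; trans; cong; subst)
open Relation.Binary.PropositionalEquality.≡-Reasoning

private variable
  A : Set
  k m n r r₁ r₂ : ℕ

Is-just-≡just : {x : Maybe A} {y : A} → x ≡ just y → Is-just x
Is-just-≡just refl = just tt

length-mapL : ∀ {B : Set} (f : A → B) (xs : List A) → length (mapL f xs) ≡ length xs
length-mapL f []       = refl
length-mapL f (x ∷ xs) = cong suc (length-mapL f xs)


Σ-cast : (eq : m ≡ n) (xs : Vec A m) → _≡_ {A = ∃ (Vec A)} (m , xs) (n , cast eq xs)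
Σ-cast refl xs = cong (_ ,_) (sym (cast-is-id refl xs))

Σ-fromList-++ : (u v : List A) →
  _≡_ {A = ∃ (Vec A)} (_ , fromList u ++ fromList v) (_ , fromList (u ++ₗ v))
Σ-fromList-++ u v = trans (cong (_ ,_) (sym (Vec.fromList-++ u)))
                          (sym (Σ-cast (length-++ u) (fromList (u ++ₗ v))))

Σ-fromList∘toList : (xs : Vec A n) → _≡_ {A = ∃ (Vec A)} (_ , fromList (toList xs)) (n , xs)
Σ-fromList∘toList xs = trans (Σ-cast (Vec.length-toList xs) _) (cong (_ ,_) (Vec.fromList∘toList xs))

zipWith-tabulate : ∀ {B C : Set} (f : A → B → C) (g : Fin n → A) (h : Fin n → B) →
  zipWith f (tabulate g) (tabulate h) ≡ tabulate (λ i → f (g i) (h i))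
zipWith-tabulate {n = zero}  f g h = refl
zipWith-tabulate {n = suc n} f g h = cong (f (g zero) (h zero) ∷_) (zipWith-tabulate f (g ∘ suc) (h ∘ suc))

toList-tabulate-const : (x : A) → toList (tabulate {n = n} λ _ → x) ≡ replicate n x
toList-tabulate-const {n = zero}  x = refl
toList-tabulate-const {n = suc n} x = cong (x ∷_) (toList-tabulate-const x)


column : Vec ℕ r → Mat
column {r} v = r , 1 , map (_∷ []) v

vcat-column : (u : Vec ℕ r₁) (v : Vec ℕ r₂) → vcat (column u) (column v) ≡ just (column (u ++ v))
vcat-column u v = cong (λ M → just (_ , 1 , M)) (sym (Vec.map-++ (_∷ []) u v))

hcat-sameRows : ∀ {c₁ c₂} (M₁ : Vec (Vec ℕ c₁) r) (M₂ : Vec (Vec ℕ c₂) r) →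
  hcat (r , c₁ , M₁) (r , c₂ , M₂) ≡ just (r , c₁ + c₂ , zipWith _++_ M₁ M₂)
hcat-sameRows {r = r} M₁ M₂ rewrite ≟-diag {r} refl = refl

indicator : ℕ → Fin n → ℕ
indicator zero    zero    = 1
indicator zero    (suc _) = 0
indicator (suc _) zero    = 0
indicator (suc a) (suc c) = indicator a c

indicator-toℕ : (t c : Fin n) → indicator (toℕ t) c ≡ (if does (t ≟ᶠ c) then 1 else 0)
indicator-toℕ zero    zero    = refl
indicator-toℕ zero    (suc c) = refl
indicator-toℕ (suc t) zero    = refl
indicator-toℕ (suc t) (suc c) = indicator-toℕ t c

-- Letters are in ℕ here; a letter ≥ σ gives an all-zero column.
marks : (σ : ℕ) → Vec ℕ n → Vec (Vec ℕ n) σ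
marks σ v = tabulate λ c → map (λ a → indicator a c) v

markMatrix : (σ : ℕ) → Vec ℕ n → Mat
markMatrix {n} σ v = σ , n , marks σ v

marks-++ : (σ : ℕ) (u : Vec ℕ r₁) (v : Vec ℕ r₂) →
  zipWith _++_ (marks σ u) (marks σ v) ≡ marks σ (u ++ v)
marks-++ σ u v = trans (zipWith-tabulate _++_ _ _)
  (Vec.tabulate-cong λ c → sym (Vec.map-++ (λ a → indicator a c) u v))

hcat-markMatrix : (σ : ℕ) (u : Vec ℕ r₁) (v : Vec ℕ r₂) →
  hcat (markMatrix σ u) (markMatrix σ v) ≡ just (markMatrix σ (u ++ v))
hcat-markMatrix σ u v = trans (hcat-sameRows (marks σ u) (marks σ v))
  (cong (λ M → just (σ , _ , M)) (marks-++ σ u v))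

markMatrix-markAllChars : (σ : ℕ) (T : Vec (Fin σ) n) →
  markMatrix σ (fromList (toList (map toℕ T))) ≡ (σ , n , markAllChars σ T)
markMatrix-markAllChars σ T = begin
  markMatrix σ (fromList (toList (map toℕ T)))
    ≡⟨ cong (λ (_ , v) → markMatrix σ v) (Σ-fromList∘toList (map toℕ T)) ⟩
  markMatrix σ (map toℕ T)
    ≡⟨ cong (λ M → σ , _ , M) (Vec.tabulate-cong λ c →
         trans (sym (Vec.map-∘ _ toℕ T)) (Vec.map-cong (λ t → indicator-toℕ t c) T)) ⟩
  (σ , _ , markAllChars σ T) ∎

markMatrix-singleton : (σ a : ℕ) → column (tabulate {n = σ} (indicator a)) ≡ markMatrix σ (a ∷ [])
markMatrix-singleton σ a = cong (λ M → σ , 1 , M) (sym (Vec.tabulate-∘ (_∷ []) (indicator a)))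

toList-indicators-< : ∀ {a} → a ≤ m →
  toList (tabulate {n = suc m} (indicator a)) ≡ replicate a 0 ++ₗ 1 ∷ replicate (m ∸ a) 0
toList-indicators-< {a = zero}  _         = cong (1 ∷_) (toList-tabulate-const 0)
toList-indicators-< {a = suc a} (s≤s a≤m) = cong (0 ∷_) (toList-indicators-< a≤m)

toList-indicators-≥ : ∀ {a} → n ≤ a → toList (tabulate {n = n} (indicator a)) ≡ replicate n 0
toList-indicators-≥ {a = a}     z≤n       = refl
toList-indicators-≥ {a = suc a} (s≤s n≤a) = cong (0 ∷_) (toList-indicators-≥ n≤a)


module _ (φ : List ℕ → Mat) {k} (g : SLG k) where

  data Concatenates : List (Fin k) → List ℕ → Set where
    [_] : ∀ {x u} → exp2 g x ≡ just (φ u) → Concatenates (x ∷ []) u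
    _∷_ : ∀ {x u xs w} → exp2 g x ≡ just (φ u) → Concatenates xs w → Concatenates (x ∷ xs) (u ++ₗ w)

  module _ {cat : Mat → Mat → Maybe Mat} (cat-φ : ∀ u v → cat (φ u) (φ v) ≡ just (φ (u ++ₗ v))) where

    foldCat-Concatenates : ∀ {xs w} → Concatenates xs w →
      Σ (List Mat) λ ms → sequenceM (mapL (exp2 g) xs) ≡ just ms
                        × ∀ acc → foldCat cat (φ acc) ms ≡ just (φ (acc ++ₗ w))
    foldCat-Concatenates {x ∷ []} {u} [ e ] rewrite e = φ u ∷ [] , refl ,
      λ acc → cong (_>>= just) (cat-φ acc u)
    foldCat-Concatenates {x ∷ xs} (_∷_ {u = u} {w = w} e c) with foldCat-Concatenates c
    ... | ms , seq , fold rewrite e | seq = φ u ∷ ms , refl ,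
      λ acc → trans (cong (_>>= λ a → foldCat cat a ms) (cat-φ acc u))
                    (trans (fold (acc ++ₗ u)) (cong (just ∘ φ) (++-assoc acc u w)))

    exp2-Concatenates : ∀ {xs w} → Concatenates xs w →
      (sequenceM (mapL (exp2 g) xs) >>= catAll cat) ≡ just (φ w)
    exp2-Concatenates [ e ] rewrite e = refl
    exp2-Concatenates (_∷_ {u = u} e c) with foldCat-Concatenates c
    ... | ms , seq , fold rewrite e | seq = fold u

Concatenates-map : ∀ {φ k k′} {g : SLG k} {g′ : SLG k′} (ι : Fin k → Fin k′) →
  (∀ x → exp2 g′ (ι x) ≡ exp2 g x) →
  ∀ {xs w} → Concatenates φ g xs w → Concatenates φ g′ (mapL ι xs) w
Concatenates-map ι exp2-ι [ e ]   = [ trans (exp2-ι _) e ]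
Concatenates-map ι exp2-ι (e ∷ c) = trans (exp2-ι _) e ∷ Concatenates-map ι exp2-ι c

listColumn : List ℕ → Mat
listColumn l = column (fromList l)

vcat-listColumn : (u v : List ℕ) → vcat (listColumn u) (listColumn v) ≡ just (listColumn (u ++ₗ v))
vcat-listColumn u v = trans (vcat-column (fromList u) (fromList v))
  (cong (λ (_ , w) → just (column w)) (Σ-fromList-++ u v))

listMarkMatrix : (σ : ℕ) → List ℕ → Mat
listMarkMatrix σ w = markMatrix σ (fromList w)

hcat-listMarkMatrix : (σ : ℕ) (u v : List ℕ) →
  hcat (listMarkMatrix σ u) (listMarkMatrix σ v) ≡ just (listMarkMatrix σ (u ++ₗ v))
hcat-listMarkMatrix σ u v = trans (hcat-markMatrix σ (fromList u) (fromList v))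
  (cong (λ (_ , w) → just (markMatrix σ w)) (Σ-fromList-++ u v))


zeroColumnRef : (m j : ℕ) → Fin (2 + m)
zeroColumnRef zero    j = zero
zeroColumnRef (suc m) j with j ≟ suc m
... | yes _ = zero
... | no  _ = suc (zeroColumnRef m j)

-- Newest first, the nonterminals are Z_m, …, Z_1, Z_0 = leaf 0 and leaf 1, where
-- Z_j expands to the zero column of height j + 1 and sits at zeroColumnRef m j.
zeroColumns : (m : ℕ) → SLG (2 + m)
zeroColumns zero    = ([] ▷ leaf 1) ▷ leaf 0
zeroColumns (suc m) = zeroColumns m ▷ hrul (zeroColumnRef m 0 ∷ zero ∷ [])

oneRef : (m : ℕ) → Fin (2 + m)
oneRef m = fromℕ (suc m)

exp2-oneRef : ∀ m → exp2 (zeroColumns m) (oneRef m) ≡ just (listColumn (1 ∷ []))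
exp2-oneRef zero    = refl
exp2-oneRef (suc m) = exp2-oneRef m

exp2-zeroColumnRef-0 : ∀ m → exp2 (zeroColumns m) (zeroColumnRef m 0) ≡ just (listColumn (0 ∷ []))
exp2-zeroColumnRef-0 zero    = refl
exp2-zeroColumnRef-0 (suc m) = exp2-zeroColumnRef-0 m

exp2-zeroColumns-newest : ∀ m → exp2 (zeroColumns m) zero ≡ just (listColumn (replicate (suc m) 0))
exp2-zeroColumns-newest zero    = refl
exp2-zeroColumns-newest (suc m) = exp2-Concatenates listColumn (zeroColumns m) vcat-listColumn
  (exp2-zeroColumnRef-0 m ∷ [ exp2-zeroColumns-newest m ])

exp2-zeroColumnRef : ∀ {m j} → j ≤ m →
  exp2 (zeroColumns m) (zeroColumnRef m j) ≡ just (listColumn (replicate (suc j) 0))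
exp2-zeroColumnRef {zero}  z≤n = refl
exp2-zeroColumnRef {suc m} {j} j≤1+m with j ≟ suc m
... | yes refl  = exp2-zeroColumns-newest (suc m)
... | no  j≢1+m = exp2-zeroColumnRef (s≤s⁻¹ (≤∧≢⇒< j≤1+m j≢1+m))

zeroColumns-expand : ∀ m (i : Fin (2 + m)) → Is-just (exp2 (zeroColumns m) i)
zeroColumns-expand zero    zero       = just tt
zeroColumns-expand zero    (suc zero) = just tt
zeroColumns-expand (suc m) zero       = Is-just-≡just (exp2-zeroColumns-newest (suc m))
zeroColumns-expand (suc m) (suc i)    = zeroColumns-expand m i

zeroColumns-hasLeaf : ∀ m → hasLeaf (zeroColumns m)
zeroColumns-hasLeaf zero    = tt
zeroColumns-hasLeaf (suc m) = zeroColumns-hasLeaf m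

size2-zeroColumns : ∀ m → size2 (zeroColumns m) ≡ 2 * suc m
size2-zeroColumns zero    = refl
size2-zeroColumns (suc m) = trans (cong (_+ 2) (size2-zeroColumns m)) (step m)
  where
  step : ∀ m → 2 * suc m + 2 ≡ 2 * suc (suc m)
  step = solve-∀


module Translation (m : ℕ) where

  σ : ℕ
  σ = suc m

  zeroColumnRefs : ℕ → List (Fin (2 + m))
  zeroColumnRefs zero    = []
  zeroColumnRefs (suc j) = zeroColumnRef m j ∷ []

  -- a zeros, a one and m ∸ a zeros; a letter ≥ σ gets the zero column Z_m.
  letterPieces : ℕ → List (Fin (2 + m))
  letterPieces a with a ≤? m
  ... | yes _ = zeroColumnRefs a ++ₗ oneRef m ∷ zeroColumnRefs (m ∸ a)
  ... | no  _ = zeroColumnRef m m ∷ []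

  onePieces-Concatenates : ∀ {b} → b ≤ m →
    Concatenates listColumn (zeroColumns m) (oneRef m ∷ zeroColumnRefs b) (1 ∷ replicate b 0)
  onePieces-Concatenates {zero}  _     = [ exp2-oneRef m ]
  onePieces-Concatenates {suc b} 1+b≤m = exp2-oneRef m ∷ [ exp2-zeroColumnRef (≤-trans (n≤1+n b) 1+b≤m) ]

  unitPieces-Concatenates : ∀ {a} → a ≤ m →
    Concatenates listColumn (zeroColumns m) (zeroColumnRefs a ++ₗ oneRef m ∷ zeroColumnRefs (m ∸ a))
                                            (replicate a 0 ++ₗ 1 ∷ replicate (m ∸ a) 0)
  unitPieces-Concatenates {zero}  _     = onePieces-Concatenates ≤-refl
  unitPieces-Concatenates {suc a} 1+a≤m =
    exp2-zeroColumnRef (≤-trans (n≤1+n a) 1+a≤m) ∷ onePieces-Concatenates (m∸n≤m m (suc a))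

  letterPieces-Concatenates : ∀ a →
    Concatenates listColumn (zeroColumns m) (letterPieces a) (toList (tabulate {n = σ} (indicator a)))
  letterPieces-Concatenates a with a ≤? m
  ... | yes a≤m = subst (Concatenates _ _ _) (sym (toList-indicators-< a≤m)) (unitPieces-Concatenates a≤m)
  ... | no  a≰m = subst (Concatenates _ _ _) (sym (toList-indicators-≥ (≰⇒> a≰m)))
                        [ exp2-zeroColumnRef ≤-refl ]

  length-zeroColumnRefs : ∀ h → length (zeroColumnRefs h) ≤ 1
  length-zeroColumnRefs zero    = z≤n
  length-zeroColumnRefs (suc _) = s≤s z≤n

  length-letterPieces : ∀ a → length (letterPieces a) ≤ 3
  length-letterPieces a with a ≤? m
  ... | yes _ = ≤-trans (≤-reflexive (length-++ (zeroColumnRefs a)))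
                        (+-mono-≤ (length-zeroColumnRefs a) (s≤s (length-zeroColumnRefs (m ∸ a))))
  ... | no  _ = s≤s z≤n

  translate : SLP k → SLG (k + (2 + m))
  translate []                   = zeroColumns m
  translate {suc k} (g ▷ term a) = translate g ▷ hrul (mapL (k ↑ʳ_) (letterPieces a))
  translate (g ▷ pair A B)       = translate g ▷ vrul ((A ↑ˡ 2 + m) ∷ (B ↑ˡ 2 + m) ∷ [])

  exp2-translate-↑ʳ : (g : SLP k) (b : Fin (2 + m)) → exp2 (translate g) (k ↑ʳ b) ≡ exp2 (zeroColumns m) b
  exp2-translate-↑ʳ []             b = refl
  exp2-translate-↑ʳ (g ▷ term _)   b = exp2-translate-↑ʳ g b
  exp2-translate-↑ʳ (g ▷ pair _ _) b = exp2-translate-↑ʳ g b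

  exp2-translate-↑ˡ : (g : SLP k) (i : Fin k) →
    exp2 (translate g) (i ↑ˡ 2 + m) ≡ just (listMarkMatrix σ (exp1 g i))
  exp2-translate-↑ˡ {suc k} (g ▷ term a) zero = begin
    exp2 (translate (g ▷ term a)) zero
      ≡⟨ exp2-Concatenates listColumn (translate g) vcat-listColumn
           (Concatenates-map (k ↑ʳ_) (exp2-translate-↑ʳ g) (letterPieces-Concatenates a)) ⟩
    just (listColumn (toList (tabulate (indicator a))))
      ≡⟨ cong (λ (_ , v) → just (column v)) (Σ-fromList∘toList (tabulate (indicator a))) ⟩
    just (column (tabulate (indicator a)))
      ≡⟨ cong just (markMatrix-singleton σ a) ⟩
    just (listMarkMatrix σ (a ∷ [])) ∎
  exp2-translate-↑ˡ (g ▷ pair A B) zero = exp2-Concatenates (listMarkMatrix σ) (translate g)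
    (hcat-listMarkMatrix σ) (exp2-translate-↑ˡ g A ∷ [ exp2-translate-↑ˡ g B ])
  exp2-translate-↑ˡ (g ▷ term _)   (suc i) = exp2-translate-↑ˡ g i
  exp2-translate-↑ˡ (g ▷ pair _ _) (suc i) = exp2-translate-↑ˡ g i

  translate-expands : (g : SLP k) (i : Fin (k + (2 + m))) → Is-just (exp2 (translate g) i)
  translate-expands []             i       = zeroColumns-expand m i
  translate-expands (g ▷ r)        zero    = Is-just-≡just (exp2-translate-↑ˡ (g ▷ r) zero)
  translate-expands (g ▷ term _)   (suc i) = translate-expands g i
  translate-expands (g ▷ pair _ _) (suc i) = translate-expands g i

  translate-hasLeaf : (g : SLP k) → hasLeaf (translate g)
  translate-hasLeaf []             = zeroColumns-hasLeaf m
  translate-hasLeaf (g ▷ term _)   = translate-hasLeaf g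
  translate-hasLeaf (g ▷ pair _ _) = translate-hasLeaf g

  +-mono-≤-3* : ∀ s c {x y} → x ≤ 3 * (s + σ) → y ≤ 3 * c → x + y ≤ 3 * (s + c + σ)
  +-mono-≤-3* s c x≤ y≤ = ≤-trans (+-mono-≤ x≤ y≤) (≤-reflexive (distrib s σ c))
    where
    distrib : ∀ s z c → 3 * (s + z) + 3 * c ≡ 3 * (s + c + z)
    distrib = solve-∀

  size2-translate : (g : SLP k) → size2 (translate g) ≤ 3 * (size1 g + σ)
  size2-translate []                   =
    ≤-trans (≤-reflexive (size2-zeroColumns m)) (*-monoˡ-≤ σ {2} {3} (s≤s (s≤s z≤n)))
  size2-translate {suc k} (g ▷ term a) = +-mono-≤-3* (size1 g) 1 (size2-translate g)
    (⊔-lub (≤-trans (≤-reflexive (length-mapL (k ↑ʳ_) (letterPieces a))) (length-letterPieces a)) (s≤s z≤n))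
  size2-translate (g ▷ pair _ _)       = +-mono-≤-3* (size1 g) 2 (size2-translate g) (s≤s (s≤s z≤n))

lemma8p16 : ∃ λ (C : ℕ) → ∀ (σ : ℕ) → 0 < σ → ∀ (n : ℕ) (T : Vec (Fin σ) n)
    → ∀ (k : ℕ) (G : SLP k) (S : Fin k) → exp1 G S ≡ toList (map toℕ T)
    → Σ ℕ λ k′ → Σ (SLG k′) λ G′ → Σ (Fin k′) λ S′
      → hasLeaf G′ × (∀ (i : Fin k′) → Is-just (exp2 G′ i))
        × exp2 G′ S′ ≡ just (σ , n , markAllChars σ T)
        × size2 G′ ≤ C * (size1 G + σ)
lemma8p16 = 3 , λ where
  (suc m) (s≤s z≤n) n T k G S exp1-S≡T → let open Translation m in
    k + (2 + m) , translate G , S ↑ˡ 2 + m , translate-hasLeaf G , translate-expands G ,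
    (begin
      exp2 (translate G) (S ↑ˡ 2 + m)                ≡⟨ exp2-translate-↑ˡ G S ⟩
      just (listMarkMatrix σ (exp1 G S))             ≡⟨ cong (λ w → just (listMarkMatrix σ w)) exp1-S≡T ⟩
      just (listMarkMatrix σ (toList (map toℕ T)))   ≡⟨ cong just (markMatrix-markAllChars σ T) ⟩
      just (σ , n , markAllChars σ T)                ∎) ,
    size2-translate G
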